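{- For all integers $c,k\ge1$, every hypergraph $H_k^c$ (constructed as in the context) can be realized by axis-parallel rectangles so that each rectangle contains an ascending set of $k$ points; that is, there exist a finite set $P\subset\mathbb{R}^2$, a bijection $\varphi$ from the vertex set of $H_k^c$ to $P$, and a family $\mathcal{R}$ of axis-parallel rectangles such that $\varphi$ maps the edge set of $H_k^c$ onto $\{P\cap R: R\in\mathcal{R}\}$ and, for each $R\in\mathcal{R}$, $P\cap R$ is an ascending set of $k$ points.
   Context: For a linearly ordered set $A=\{a_1<a_2<\dots<a_{tm}\}$, its blocks are $\{a_{im+1},\dots,a_{im+m}\}$, $i=0,\dots,t-1$, and $f_m(A)$ is the family of subsets of $A$ containing exactly one element of each block. Fix $k\ge1$. The vertex-ordered hypergraphs $H_k^c$ are defined recursively in $c$. $H_k^1$: $k$ vertices with an arbitrary linear order and one edge consisting of all $k$ vertices. For $c>1$, take some $H_k^{c-1}$ and let $m$ be its number of vertices. Build a rooted forest whose vertices are partitioned into stages; a stage $S$ of level $j$ is a set of $m^{k-j}$ vertices with a linear order $<_S$. There is one stage of level $0$: $m^k$ vertices in some order, the roots. For each stage $S$ of level $j<k-1$ and each $S'\in f_m(S)$, create a new stage $T(S')$ of level $j+1$ consisting of $m^{k-j-1}$ new vertices, one child of each vertex of $S'$, ordered as their parents are ordered in $<_S$. Stages of level $k-1$ have no children. The vertex set of $H_k^c$ is the set of all forest vertices. Edges: (path edges) for each vertex $v$ in a stage of level $k-1$, the vertex set of the forest path from $v$ to its root; (transversal edges) for each stage $S$ of level $j$, partition $S$ into its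 $m^{k-j-1}$ blocks of $m$ consecutive vertices in $<_S$, and on each block place the edges of a copy of $H_k^{c-1}$ via the order-preserving bijection from the vertices of $H_k^{c-1}$ to the block. $H_k^c$ is given an arbitrary linear order of its vertices. An axis-parallel rectangle is a set $\{(x,y): x_1\le x\le x_2,\ y_1\le y\le y_2\}$. A point set $Q=\{p_1,\dots,p_n\}$ with $x(p_1)<\dots<x(p_n)$ is ascending if $y(p_1)<\dots<y(p_n)$. -}

module Defs where

open import Data.Nat using (ℕ; zero; suc; _^_; _≤_)
open import Data.Nat.Properties using (*-comm)
open import Data.Fin using (Fin; combine; cast) renaming (_<_ to _<ᶠ_)
open import Data.Vec using (Vec; lookup)
open import Data.List using (List; []; _∷_)
open import Data.List.Membership.Propositional using (_∈_)
open import Data.Product using (Σ; ∃; _×_; _,_; proj₁; proj₂)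
open import Data.Sum using (_⊎_; inj₁; inj₂)
open import Data.Unit using (⊤)
open import Data.Rational using (ℚ) renaming (_≤_ to _≤ℚ_; _<_ to _<ℚ_)
open import Function.Bundles using (_↔_; Inverse; _⇔_)
open import Function.Definitions using (Injective)
open import Relation.Binary.PropositionalEquality using (_≡_)

-- Vertex-ordered hypergraphs: vertex set Fin nV, ordered as in Fin.
-- The edge set is { mem e | e : Edge } (an indexed family of subsets).

record OHyp : Set₁ where
  field
    nV   : ℕ
    Edge : Set
    mem  : Edge → Fin nV → Set

open OHyp public

-- The rooted forest of the construction, for a fixed k and
-- m = number of vertices of H_k^{c-1}.
--
-- A stage of height h has m ^ h vertices; its vertices are the
-- positions Fin (m ^ h), ordered as in Fin (this is the order <_S).
-- Stage level j corresponds to height k - j.  Position  b * m + i  (b : Fin (m ^ h), i : Fin m) is the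
-- i-th vertex of the b-th block of a stage of height (suc h).

pos : ∀ {m} h → Fin (m ^ h) → Fin m → Fin (m ^ suc h)
pos {m} h b i = cast (*-comm (m ^ h) m) (combine b i)

-- A child stage of a stage S of height (suc (suc h)) is given
-- by an element S' of f_m(S): one chosen index (in Fin m) for each of
-- the m ^ (suc h) blocks of S.  The child T(S') has height (suc h);
-- its b-th vertex is the child of the chosen vertex of block b.
data Stage (k m : ℕ) : ℕ → Set where
  root  : Stage k m k
  child : ∀ {h} → Stage k m (suc (suc h)) → Vec (Fin m) (m ^ suc h)
        → Stage k m (suc h)

Vertex : ℕ → ℕ → Set
Vertex k m = Σ ℕ λ h → Σ (Stage k m h) λ _ → Fin (m ^ h)

pathToRoot : ∀ {k m h} → Stage k m h → Fin (m ^ h) → List (Vertex k m)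
pathToRoot {h = h} root p = (h , root , p) ∷ []
pathToRoot {h = suc h} (child S σ) b =
  (suc h , child S σ , b) ∷ pathToRoot S (pos (suc h) b (lookup σ b))

-- Edge indices of H_k^c (on the forest vertices):
--   path edges: one per vertex of a stage of level k-1 (height 1);
--   transversal edges: stage S of height (suc h), block b, edge e of H'.
ForestEdge : ℕ → OHyp → Set
ForestEdge k H' =
    (Σ (Stage k (nV H') 1) λ _ → Fin (nV H' ^ 1))
  ⊎ (Σ ℕ λ h → Σ (Stage k (nV H') (suc h)) λ _ →
       Σ (Fin (nV H' ^ h)) λ _ → Edge H')

forestMem : ∀ k (H' : OHyp) → ForestEdge k H' → Vertex k (nV H') → Set
forestMem k H' (inj₁ (S , p)) v = v ∈ pathToRoot S p
forestMem k H' (inj₂ (h , S , b , e)) v =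
  ∃ λ (i : Fin (nV H')) → mem H' e i × (v ≡ (suc h , S , pos h b i))

-- The family of all hypergraphs H_k^c (over all the arbitrary choices).
-- In a step, ord : Fin n ↔ Vertex k m is the arbitrary linear order of
-- the vertices of H_k^c (vertex t : Fin n is the t-th vertex).

mutual
  data HData (k : ℕ) : ℕ → Set where
    base : HData k 1
    step : ∀ {c} (d : HData k c) (n : ℕ) → Fin n ↔ Vertex k (nV (hyp d))
         → HData k (suc c)

  hyp : ∀ {k c} → HData k c → OHyp
  hyp {k} base = record { nV = k ; Edge = ⊤ ; mem = λ _ _ → ⊤ }
  hyp {k} (step d n ord) = record
    { nV   = n
    ; Edge = ForestEdge k (hyp d)
    ; mem  = λ e t → forestMem k (hyp d) e (Inverse.to ord t)
    }

Point : Set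
Point = ℚ × ℚ

x y : Point → ℚ
x = proj₁
y = proj₂

record Rect : Set where
  field
    x₁ x₂ y₁ y₂ : ℚ

InRect : Rect → Point → Set
InRect R p = (Rect.x₁ R ≤ℚ x p × x p ≤ℚ Rect.x₂ R)
           × (Rect.y₁ R ≤ℚ y p × y p ≤ℚ Rect.y₂ R)

AscendingSetOf : ℕ → (Point → Set) → Set
AscendingSetOf k Q = Σ (Fin k → Point) λ p →
    (∀ q → Q q ⇔ (∃ λ i → q ≡ p i))
  × (∀ i j → i <ᶠ j → (x (p i) <ℚ x (p j)) × (y (p i) <ℚ y (p j)))

InP∩ : ∀ {n} → (Fin n → Point) → Rect → Point → Set
InP∩ φ R q = (∃ λ v → φ v ≡ q) × InRect R q

RealizedAscending : ℕ → OHyp → Set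
RealizedAscending k H =
  Σ (Fin (nV H) → Point) λ φ → Injective _≡_ _≡_ φ ×
  Σ (List Rect) λ Rs →
      (∀ e → ∃ λ R → R ∈ Rs × (∀ q → (∃ λ v → mem H e v × φ v ≡ q) ⇔ InP∩ φ R q))
    × (∀ R → R ∈ Rs → ∃ λ e → (∀ q → (∃ λ v → mem H e v × φ v ≡ q) ⇔ InP∩ φ R q))
    × (∀ R → R ∈ Rs → AscendingSetOf k (InP∩ φ R))

-- The proof goes by induction on c through a purely order-theoretic realization: two
-- injective coordinates in which every edge is a chain increasing in both, and the box
-- spanned by the first and last vertex of an edge contains no other vertex.  Ranking the
-- coordinates and embedding the ranks in ℚ gives the points and rectangles.
--
-- In the step, a forest vertex is given lexicographic keys made of its stage word (the
-- choices leading from the root stage to its stage) and of the base-m digits of its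
-- position, read through the coordinates of H_k^{c-1}.  In x, a stage comes after all the
-- stages below it, and sibling stages are ordered by their choice vectors.  In y, vertices
-- are first grouped by their root, ordered by the y-digits of the root, and then ordered
-- by stage as in x but with siblings in the reverse order.  A transversal edge lies in
-- one block, where both keys order it as H_k^{c-1} does, so its box is inherited.  Along
-- a path both keys increase towards the root, and a vertex in the box of a path has the
-- same root and a stage word that is a prefix of the path's: diverging stage words are
-- ordered oppositely by the two keys.  So it lies on the path.
module Submission where

open import Defs
open import Level using (0ℓ)
open import Data.Nat as ℕ using (ℕ; zero; suc; _+_; _∸_; _^_; z≤n; s≤s)
import Data.Nat.Properties as ℕP
open import Data.Nat.Coprimality using (1-coprimeTo) renaming (sym to coprime-sym)
open import Data.Integer as ℤ using (+_)
import Data.Integer.Properties as ℤP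
open import Data.Rational using (ℚ; mkℚ; *≤*; *<*) renaming (_≤_ to _≤ℚ_; _<_ to _<ℚ_)
import Data.Rational.Properties as ℚP
open import Data.Fin as F using (Fin; toℕ; fromℕ) renaming (_<_ to _<ᶠ_)
import Data.Fin.Properties as FP
open import Data.Vec using (Vec; lookup; toList)
import Data.Vec.Properties as VP
open import Data.List using (List; []; _∷_; _++_; _∷ʳ_; length; map; concatMap; allFin)
import Data.List.Properties as LP
open import Data.List.Membership.Propositional using (_∈_; lose)
open import Data.List.Membership.Propositional.Properties
  using (∈-allFin; ∈-map⁺; ∈-map⁻; ∈-++⁺ʳ; ∈-++⁻; ∈-concatMap⁺; ∈-concatMap⁻)
open import Data.List.Relation.Unary.Any using (here; there; satisfied)
open import Data.Product as Prod using (Σ; ∃; ∃₂; _×_; _,_; proj₁; proj₂)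
open import Data.Product.Properties using (,-injectiveˡ; ,-injectiveʳ)
open import Data.Sum using (_⊎_; inj₁; inj₂)
open import Data.Unit using (tt)
open import Data.Empty using (⊥; ⊥-elim)
open import Function using (_∘_)
open import Function.Bundles using (_⇔_; mk⇔; _↔_; Inverse)
open import Function.Definitions using (Injective)
open import Relation.Nullary using (¬_; yes; no)
open import Relation.Binary
  using (Rel; Transitive; IsStrictTotalOrder; DecidableEquality; Tri; tri<; tri≈; tri>)
open import Relation.Binary.Construct.Closure.Reflexive using (ReflClosure; refl; [_]; reflexive)
import Relation.Binary.Construct.Closure.Reflexive.Properties as Refl
open import Relation.Binary.PropositionalEquality as ≡
  using (_≡_; _≢_; cong; cong₂; sym; trans; subst; subst₂)

-- Strict total orders, lexicographic orders and ranks

module StrictTotalOrderProperties {A : Set} {_<_ : Rel A 0ℓ} (<-sto : IsStrictTotalOrder _≡_ _<_)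
  where
  open IsStrictTotalOrder <-sto public
    using (compare; _<?_) renaming (irrefl to <-irrefl; trans to <-trans)

  infix 4 _≤_
  _≤_ : Rel A 0ℓ
  _≤_ = ReflClosure _<_

  <-≤-trans : ∀ {x y z} → x < y → y ≤ z → x < z
  <-≤-trans x<y refl    = x<y
  <-≤-trans x<y [ y<z ] = <-trans x<y y<z

  <⇒≱ : ∀ {x y} → x < y → ¬ (y ≤ x)
  <⇒≱ x<y y≤x = <-irrefl ≡.refl (<-≤-trans x<y y≤x)

  ≤-antisym : ∀ {x y} → x ≤ y → y ≤ x → x ≡ y
  ≤-antisym refl    _   = ≡.refl
  ≤-antisym [ x<y ] y≤x = ⊥-elim (<⇒≱ x<y y≤x)

  ≤∧≢⇒< : ∀ {x y} → x ≤ y → x ≢ y → x < y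
  ≤∧≢⇒< refl    x≢x = ⊥-elim (x≢x ≡.refl)
  ≤∧≢⇒< [ x<y ] _   = x<y

module Lex {A : Set} {_≺_ : Rel A 0ℓ} (≺-sto : IsStrictTotalOrder _≡_ _≺_) where
  private module Elem = StrictTotalOrderProperties ≺-sto
  open Elem using () renaming (_≤_ to _≼_)

  infix 4 _<_
  data _<_ : Rel (List A) 0ℓ where
    halt : ∀ {y ys}      → [] < y ∷ ys
    this : ∀ {x y xs ys} → x ≺ y → x ∷ xs < y ∷ ys
    next : ∀ {x y xs ys} → x ≡ y → xs < ys → x ∷ xs < y ∷ ys

  private
    <-irreflexive : ∀ {xs} → ¬ (xs < xs)
    <-irreflexive (this x≺x)     = Elem.<-irrefl ≡.refl x≺x
    <-irreflexive (next _ xs<xs) = <-irreflexive xs<xs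

    <-transitive : Transitive _<_
    <-transitive halt            (this _)        = halt
    <-transitive halt            (next _ _)      = halt
    <-transitive (this p)        (this q)        = this (Elem.<-trans p q)
    <-transitive (this p)        (next ≡.refl _) = this p
    <-transitive (next ≡.refl _) (this q)        = this q
    <-transitive (next ≡.refl p) (next ≡.refl q) = next ≡.refl (<-transitive p q)

    <-asymmetric : ∀ {xs ys} → xs < ys → ¬ (ys < xs)
    <-asymmetric p q = <-irreflexive (<-transitive p q)

    tri-< : ∀ {xs ys} → xs < ys → Tri (xs < ys) (xs ≡ ys) (ys < xs)
    tri-< p = tri< p (λ { ≡.refl → <-irreflexive p }) (<-asymmetric p)

    tri-> : ∀ {xs ys} → ys < xs → Tri (xs < ys) (xs ≡ ys) (ys < xs)
    tri-> p = tri> (<-asymmetric p) (λ { ≡.refl → <-irreflexive p }) p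

    <-compare : ∀ xs ys → Tri (xs < ys) (xs ≡ ys) (ys < xs)
    <-compare []       []       = tri≈ <-irreflexive ≡.refl <-irreflexive
    <-compare []       (y ∷ ys) = tri-< halt
    <-compare (x ∷ xs) []       = tri-> halt
    <-compare (x ∷ xs) (y ∷ ys) with Elem.compare x y
    ... | tri< x≺y _ _ = tri-< (this x≺y)
    ... | tri> _ _ y≺x = tri-> (this y≺x)
    ... | tri≈ _ ≡.refl _ with <-compare xs ys
    ...   | tri< xs<ys _ _  = tri-< (next ≡.refl xs<ys)
    ...   | tri≈ _ ≡.refl _ = tri≈ <-irreflexive ≡.refl <-irreflexive
    ...   | tri> _ _ ys<xs  = tri-> (next ≡.refl ys<xs)

  isStrictTotalOrder : IsStrictTotalOrder _≡_ _<_
  isStrictTotalOrder = record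
    { isStrictPartialOrder = record
      { isEquivalence = ≡.isEquivalence
      ; irrefl        = λ { ≡.refl → <-irreflexive }
      ; trans         = <-transitive
      ; <-resp-≈      = ≡.resp₂ _<_
      }
    ; compare = <-compare
    }

  open StrictTotalOrderProperties isStrictTotalOrder public hiding (compare; _<?_)

  ++⁺ˡ : ∀ zs {xs ys} → xs < ys → zs ++ xs < zs ++ ys
  ++⁺ˡ []       p = p
  ++⁺ˡ (z ∷ zs) p = next ≡.refl (++⁺ˡ zs p)

  ++⁻ˡ : ∀ zs {xs ys} → zs ++ xs < zs ++ ys → xs < ys
  ++⁻ˡ []       p          = p
  ++⁻ˡ (z ∷ zs) (this z≺z) = ⊥-elim (Elem.<-irrefl ≡.refl z≺z)
  ++⁻ˡ (z ∷ zs) (next _ p) = ++⁻ˡ zs p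

  ++⁻ˡ-≤ : ∀ zs {xs ys} → zs ++ xs ≤ zs ++ ys → xs ≤ ys
  ++⁻ˡ-≤ zs p with Refl.toSum p
  ... | inj₁ eq = reflexive (LP.++-cancelˡ zs _ _ eq)
  ... | inj₂ p′ = [ ++⁻ˡ zs p′ ]

  ∷⁻-≤ : ∀ {x y xs ys} → x ∷ xs ≤ y ∷ ys → x ≼ y
  ∷⁻-≤ refl             = refl
  ∷⁻-≤ [ this x≺y ]     = [ x≺y ]
  ∷⁻-≤ [ next x≡y _ ]   = reflexive x≡y

  ≤-tail : ∀ {x y xs ys} → x ≡ y → x ∷ xs ≤ y ∷ ys → xs ≤ ys
  ≤-tail ≡.refl = ++⁻ˡ-≤ (_ ∷ [])

  ++-sandwich : ∀ xs ys {us vs ws} → length xs ≡ length ys →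
                xs ++ us ≤ ys ++ vs → ys ++ vs ≤ xs ++ ws → xs ≡ ys
  ++-sandwich []       []       _  _ _ = ≡.refl
  ++-sandwich (x ∷ xs) (y ∷ ys) eq p q with Elem.≤-antisym (∷⁻-≤ p) (∷⁻-≤ q)
  ... | ≡.refl =
    cong (x ∷_) (++-sandwich xs ys (ℕP.suc-injective eq) (≤-tail ≡.refl p) (≤-tail ≡.refl q))

module ℕ< = StrictTotalOrderProperties ℕP.<-isStrictTotalOrder
module Lex₁ = Lex ℕP.<-isStrictTotalOrder
module Lex₂ = Lex Lex₁.isStrictTotalOrder

module Ranking {A : Set} {_<_ : Rel A 0ℓ} (<-sto : IsStrictTotalOrder _≡_ _<_) where
  open StrictTotalOrderProperties <-sto

  countBelow : A → List A → ℕ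
  countBelow a []       = 0
  countBelow a (x ∷ xs) with x <? a
  ... | yes _ = suc (countBelow a xs)
  ... | no  _ = countBelow a xs

  countBelow-mono : ∀ {a b} xs → a < b → countBelow a xs ℕ.≤ countBelow b xs
  countBelow-mono []       a<b = z≤n
  countBelow-mono {a} {b} (x ∷ xs) a<b with x <? a | x <? b
  ... | yes _   | yes _   = s≤s (countBelow-mono xs a<b)
  ... | yes x<a | no  x≮b = ⊥-elim (x≮b (<-trans x<a a<b))
  ... | no  _   | yes _   = ℕP.m≤n⇒m≤1+n (countBelow-mono xs a<b)
  ... | no  _   | no  _   = countBelow-mono xs a<b

  countBelow-mono-< : ∀ {a b xs} → a ∈ xs → a < b → countBelow a xs ℕ.< countBelow b xs
  countBelow-mono-< {a} {b} {x ∷ xs} (here ≡.refl) a<b with a <? a | a <? b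
  ... | yes a<a | _       = ⊥-elim (<-irrefl ≡.refl a<a)
  ... | no  _   | yes _   = s≤s (countBelow-mono xs a<b)
  ... | no  _   | no  a≮b = ⊥-elim (a≮b a<b)
  countBelow-mono-< {a} {b} {x ∷ xs} (there a∈xs) a<b with x <? a | x <? b
  ... | yes _   | yes _   = s≤s (countBelow-mono-< a∈xs a<b)
  ... | yes x<a | no  x≮b = ⊥-elim (x≮b (<-trans x<a a<b))
  ... | no  _   | yes _   = ℕP.m<n⇒m<1+n (countBelow-mono-< a∈xs a<b)
  ... | no  _   | no  _   = countBelow-mono-< a∈xs a<b

  module _ {n} (key : Fin n → A) where

    rank : Fin n → ℕ
    rank t = countBelow (key t) (map key (allFin n))

    rank-mono-< : ∀ {s t} → key s < key t → rank s ℕ.< rank t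
    rank-mono-< {s} = countBelow-mono-< (∈-map⁺ key (∈-allFin s))

    rank-cancel-≤ : ∀ {s t} → rank s ℕ<.≤ rank t → key s ≤ key t
    rank-cancel-≤ {s} {t} r with compare (key s) (key t)
    ... | tri< ks<kt _ _ = [ ks<kt ]
    ... | tri≈ _ ks≡kt _ = reflexive ks≡kt
    ... | tri> _ _ kt<ks = ⊥-elim (ℕ<.<⇒≱ (rank-mono-< kt<ks) r)

    rank-injective : ∀ {s t} → rank s ≡ rank t → key s ≡ key t
    rank-injective {s} {t} eq with compare (key s) (key t)
    ... | tri< ks<kt _ _ = ⊥-elim (ℕP.<⇒≢ (rank-mono-< ks<kt) eq)
    ... | tri≈ _ ks≡kt _ = ks≡kt
    ... | tri> _ _ kt<ks = ⊥-elim (ℕP.<⇒≢ (rank-mono-< kt<ks) (sym eq))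

-- Chain realizations

-- The rectangles have to form a list while the edge type need not be finite, hence the
-- list of corner pairs.
record ChainRealization {A : Set} (_<_ : Rel A 0ℓ) (k : ℕ) {V E : Set} (mem : E → V → Set)
       : Set where
  private
    _≤_ = ReflClosure _<_
  field
    X Y         : V → A
    X-injective : Injective _≡_ _≡_ X
    Y-injective : Injective _≡_ _≡_ Y
    chain       : E → Fin (suc k) → V
    chain-mem   : ∀ e i → mem e (chain e i)
    mem-chain   : ∀ e v → mem e v → ∃ λ i → v ≡ chain e i
    X-chain-<   : ∀ e {i j} → i <ᶠ j → X (chain e i) < X (chain e j)
    Y-chain-<   : ∀ e {i j} → i <ᶠ j → Y (chain e i) < Y (chain e j)
    box         : ∀ e v →
                  X (chain e F.zero) ≤ X v → X v ≤ X (chain e (fromℕ k)) →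
                  Y (chain e F.zero) ≤ Y v → Y v ≤ Y (chain e (fromℕ k)) →
                  ∃ λ i → v ≡ chain e i
    corners          : List (V × V)
    corners-complete : ∀ e → (chain e F.zero , chain e (fromℕ k)) ∈ corners
    corners-sound    : ∀ {c} → c ∈ corners →
                       ∃ λ e → (chain e F.zero , chain e (fromℕ k)) ≡ c

module _ {A : Set} {_<_ : Rel A 0ℓ} {k : ℕ} (f : Fin (suc k) → A)
         (f-< : ∀ {i j} → i <ᶠ j → f i < f j) where

  first-≤ : ∀ i → ReflClosure _<_ (f F.zero) (f i)
  first-≤ F.zero    = refl
  first-≤ (F.suc i) = [ f-< (s≤s z≤n) ]

  ≤-last : ∀ i → ReflClosure _<_ (f i) (f (fromℕ k))
  ≤-last i with FP.<-cmp i (fromℕ k)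
  ... | tri< i<last _ _ = [ f-< i<last ]
  ... | tri≈ _ ≡.refl _ = refl
  ... | tri> _ _ last<i = ⊥-elim (ℕP.<⇒≱ last<i (FP.≤fromℕ i))

rankRealization : ∀ {A} {_<_ : Rel A 0ℓ} {k n E} {mem : E → Fin n → Set} →
                  IsStrictTotalOrder _≡_ _<_ →
                  ChainRealization _<_ k mem → ChainRealization ℕ._<_ k mem
rankRealization <-sto R = record
  { X = rank X ; Y = rank Y
  ; X-injective = X-injective ∘ rank-injective X
  ; Y-injective = Y-injective ∘ rank-injective Y
  ; chain = chain ; chain-mem = chain-mem ; mem-chain = mem-chain
  ; X-chain-< = λ e i<j → rank-mono-< X (X-chain-< e i<j)
  ; Y-chain-< = λ e i<j → rank-mono-< Y (Y-chain-< e i<j)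
  ; box = λ e v x₁ x₂ y₁ y₂ → box e v (rank-cancel-≤ X x₁) (rank-cancel-≤ X x₂)
                                      (rank-cancel-≤ Y y₁) (rank-cancel-≤ Y y₂)
  ; corners = corners ; corners-complete = corners-complete ; corners-sound = corners-sound
  }
  where
  open ChainRealization R
  open Ranking <-sto

relabel : ∀ {A} {_<_ : Rel A 0ℓ} {k V W E} {mem : E → V → Set} (f : W ↔ V) →
          ChainRealization _<_ k mem → ChainRealization _<_ k (λ e w → mem e (Inverse.to f w))
relabel {_<_ = _<_} {k} {V} {mem = mem} f R = record
  { X = X ∘ to ; Y = Y ∘ to
  ; X-injective = to-injective ∘ X-injective
  ; Y-injective = to-injective ∘ Y-injective
  ; chain = λ e i → from (chain e i)
  ; chain-mem = λ e i → back (mem e) (chain-mem e i)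
  ; mem-chain = λ e w w∈e → let i , w≡ = mem-chain e (to w) w∈e in i , from-unique w≡
  ; X-chain-< = λ e i<j → back₂ (λ u v → X u < X v) (X-chain-< e i<j)
  ; Y-chain-< = λ e i<j → back₂ (λ u v → Y u < Y v) (Y-chain-< e i<j)
  ; box = λ e w x₁ x₂ y₁ y₂ →
      let i , w≡ = box e (to w)
                       (forth (λ u → X u ≤ X (to w)) x₁) (forth (λ u → X (to w) ≤ X u) x₂)
                       (forth (λ u → Y u ≤ Y (to w)) y₁) (forth (λ u → Y (to w) ≤ Y u) y₂)
      in i , from-unique w≡
  ; corners = map (Prod.map from from) corners
  ; corners-complete = λ e → ∈-map⁺ _ (corners-complete e)
  ; corners-sound = relabelled-sound
  }
  where
  open ChainRealization R
  open Inverse f using (to; from)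
  _≤_ = ReflClosure _<_
  to-from : ∀ v → to (from v) ≡ v
  to-from = Inverse.strictlyInverseˡ f
  from-unique : ∀ {w v} → to w ≡ v → w ≡ from v
  from-unique {w} to-w≡v = trans (sym (Inverse.strictlyInverseʳ f w)) (cong from to-w≡v)
  to-injective : Injective _≡_ _≡_ to
  to-injective {w} eq = trans (from-unique eq) (Inverse.strictlyInverseʳ f _)
  back : ∀ (P : V → Set) {v} → P v → P (to (from v))
  back P {v} = subst P (sym (to-from v))
  forth : ∀ (P : V → Set) {v} → P (to (from v)) → P v
  forth P {v} = subst P (to-from v)
  back₂ : ∀ (P : V → V → Set) {u v} → P u v → P (to (from u)) (to (from v))
  back₂ P {u} {v} = subst₂ P (sym (to-from u)) (sym (to-from v))
  relabelled-sound : ∀ {c} → c ∈ map (Prod.map from from) corners →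
                     ∃ λ e → (from (chain e F.zero) , from (chain e (fromℕ k))) ≡ c
  relabelled-sound c∈ with ∈-map⁻ _ c∈
  ... | _ , c∈′ , ≡.refl with corners-sound c∈′
  ...   | e , ≡.refl = e , ≡.refl

baseRealization : ∀ k → ChainRealization ℕ._<_ k (mem (hyp {suc k} base))
baseRealization k = record
  { X = toℕ ; Y = toℕ ; X-injective = FP.toℕ-injective ; Y-injective = FP.toℕ-injective
  ; chain = λ _ i → i ; chain-mem = λ _ _ → tt ; mem-chain = λ _ v _ → v , ≡.refl
  ; X-chain-< = λ _ i<j → i<j ; Y-chain-< = λ _ i<j → i<j
  ; box = λ _ v _ _ _ _ → v , ≡.refl
  ; corners = (F.zero , fromℕ k) ∷ [] ; corners-complete = λ _ → here ≡.refl
  ; corners-sound = λ { (here ≡.refl) → tt , ≡.refl }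
  }

ℕ→ℚ : ℕ → ℚ
ℕ→ℚ n = mkℚ (+ n) 0 (coprime-sym (1-coprimeTo n))

private
  n*1≡n : ∀ n → + n ℤ.* + 1 ≡ + n
  n*1≡n n = ℤP.*-identityʳ (+ n)

ℕ→ℚ-mono-< : ∀ {a b} → a ℕ.< b → ℕ→ℚ a <ℚ ℕ→ℚ b
ℕ→ℚ-mono-< {a} {b} a<b = *<* (subst₂ ℤ._<_ (sym (n*1≡n a)) (sym (n*1≡n b)) (ℤ.+<+ a<b))

ℕ→ℚ-mono-≤ : ∀ {a b} → a ℕ<.≤ b → ℕ→ℚ a ≤ℚ ℕ→ℚ b
ℕ→ℚ-mono-≤ refl    = ℚP.≤-refl
ℕ→ℚ-mono-≤ [ a<b ] = ℚP.<⇒≤ (ℕ→ℚ-mono-< a<b)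

ℕ→ℚ-cancel-≤ : ∀ {a b} → ℕ→ℚ a ≤ℚ ℕ→ℚ b → a ℕ<.≤ b
ℕ→ℚ-cancel-≤ {a} {b} (*≤* p)
  with ℕP.m≤n⇒m<n∨m≡n (ℤP.drop‿+≤+ (subst₂ ℤ._≤_ (n*1≡n a) (n*1≡n b) p))
... | inj₁ a<b    = [ a<b ]
... | inj₂ ≡.refl = refl

ℕ→ℚ-injective : Injective _≡_ _≡_ ℕ→ℚ
ℕ→ℚ-injective ≡.refl = ≡.refl

module _ {k : ℕ} {H : OHyp} (R : ChainRealization ℕ._<_ k (mem H)) where
  open ChainRealization R

  point : Fin (nV H) → Point
  point v = ℕ→ℚ (X v) , ℕ→ℚ (Y v)

  spanned : Fin (nV H) × Fin (nV H) → Rect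
  spanned (a , b) = record
    { x₁ = ℕ→ℚ (X a) ; x₂ = ℕ→ℚ (X b) ; y₁ = ℕ→ℚ (Y a) ; y₂ = ℕ→ℚ (Y b) }

  rect : Edge H → Rect
  rect e = spanned (chain e F.zero , chain e (fromℕ k))

  chain-in-rect : ∀ e i → InRect (rect e) (point (chain e i))
  chain-in-rect e i =
    (ℕ→ℚ-mono-≤ (first-≤ (X ∘ chain e) (X-chain-< e) i) ,
     ℕ→ℚ-mono-≤ (≤-last (X ∘ chain e) (X-chain-< e) i)) ,
    (ℕ→ℚ-mono-≤ (first-≤ (Y ∘ chain e) (Y-chain-< e) i) ,
     ℕ→ℚ-mono-≤ (≤-last (Y ∘ chain e) (Y-chain-< e) i))

  in-rect-chain : ∀ e v → InRect (rect e) (point v) → ∃ λ i → v ≡ chain e i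
  in-rect-chain e v ((x₁ , x₂) , (y₁ , y₂)) =
    box e v (ℕ→ℚ-cancel-≤ x₁) (ℕ→ℚ-cancel-≤ x₂) (ℕ→ℚ-cancel-≤ y₁) (ℕ→ℚ-cancel-≤ y₂)

  edge⇔rect : ∀ e q → (∃ λ v → mem H e v × point v ≡ q) ⇔ InP∩ point (rect e) q
  edge⇔rect e q = mk⇔ to from
    where
    to : (∃ λ v → mem H e v × point v ≡ q) → InP∩ point (rect e) q
    to (v , v∈e , ≡.refl) with mem-chain e v v∈e
    ... | i , ≡.refl = (v , ≡.refl) , chain-in-rect e i
    from : InP∩ point (rect e) q → ∃ λ v → mem H e v × point v ≡ q
    from ((v , ≡.refl) , v∈R) with in-rect-chain e v v∈R
    ... | i , ≡.refl = chain e i , chain-mem e i , ≡.refl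

  rect-ascending : ∀ e → AscendingSetOf (suc k) (InP∩ point (rect e))
  rect-ascending e =
    point ∘ chain e , (λ q → mk⇔ to from) ,
    λ i j i<j → ℕ→ℚ-mono-< (X-chain-< e i<j) , ℕ→ℚ-mono-< (Y-chain-< e i<j)
    where
    to : ∀ {q} → InP∩ point (rect e) q → ∃ λ i → q ≡ point (chain e i)
    to ((v , ≡.refl) , v∈R) with in-rect-chain e v v∈R
    ... | i , ≡.refl = i , ≡.refl
    from : ∀ {q} → (∃ λ i → q ≡ point (chain e i)) → InP∩ point (rect e) q
    from (i , ≡.refl) = (chain e i , ≡.refl) , chain-in-rect e i

  rect-of-corner : ∀ {Q} → Q ∈ map spanned corners → ∃ λ e → Q ≡ rect e
  rect-of-corner Q∈ with ∈-map⁻ spanned Q∈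
  ... | c , c∈ , ≡.refl with corners-sound c∈
  ...   | e , ≡.refl = e , ≡.refl

  realize : RealizedAscending (suc k) H
  realize = point , X-injective ∘ ℕ→ℚ-injective ∘ cong proj₁ , map spanned corners ,
            (λ e → rect e , ∈-map⁺ spanned (corners-complete e) , edge⇔rect e) ,
            edge-of-rect , ascending
    where
    edge-of-rect : ∀ Q → Q ∈ map spanned corners →
                   ∃ λ e → ∀ q → (∃ λ v → mem H e v × point v ≡ q) ⇔ InP∩ point Q q
    edge-of-rect Q Q∈ with rect-of-corner Q∈
    ... | e , ≡.refl = e , edge⇔rect e
    ascending : ∀ Q → Q ∈ map spanned corners → AscendingSetOf (suc k) (InP∩ point Q)
    ascending Q Q∈ with rect-of-corner Q∈
    ... | e , ≡.refl = rect-ascending e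

data Divergence {A : Set} : List A → List A → Set where
  equal     : ∀ {xs}           → Divergence xs xs
  prefix    : ∀ {xs y ys}      → Divergence xs (xs ++ y ∷ ys)
  extension : ∀ {x xs ys}      → Divergence (ys ++ x ∷ xs) ys
  diverge   : ∀ {zs x y xs ys} → x ≢ y → Divergence (zs ++ x ∷ xs) (zs ++ y ∷ ys)

divergence : ∀ {A : Set} → DecidableEquality A → ∀ xs ys → Divergence {A} xs ys
divergence _≟_ []       []       = equal
divergence _≟_ []       (y ∷ ys) = prefix
divergence _≟_ (x ∷ xs) []       = extension
divergence _≟_ (x ∷ xs) (y ∷ ys) with x ≟ y
... | no x≢y     = diverge {zs = []} x≢y
... | yes ≡.refl with divergence _≟_ xs ys
...   | equal             = equal
...   | prefix            = prefix
...   | extension         = extension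
...   | diverge {zs} x≢y  = diverge {zs = x ∷ zs} x≢y

∷ʳ-≡-++ : ∀ {A : Set} (xs ys zs : List A) {x} → xs ∷ʳ x ≡ ys ++ zs →
          zs ≡ [] ⊎ ∃ λ zs′ → xs ≡ ys ++ zs′
∷ʳ-≡-++ xs       []            zs       _  = inj₂ (xs , ≡.refl)
∷ʳ-≡-++ []       (y ∷ ys)      []       _  = inj₁ ≡.refl
∷ʳ-≡-++ []       (y ∷ [])      (z ∷ zs) ()
∷ʳ-≡-++ []       (y ∷ y′ ∷ ys) (z ∷ zs) ()
∷ʳ-≡-++ (x ∷ xs) (y ∷ ys)      zs       eq with LP.∷-injective eq
... | ≡.refl , eq′ with ∷ʳ-≡-++ xs ys zs eq′
...   | inj₁ zs≡[]          = inj₁ zs≡[]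
...   | inj₂ (zs′ , ≡.refl) = inj₂ (zs′ , ≡.refl)

∷ʳ≢[] : ∀ {A : Set} (xs : List A) {x} → xs ∷ʳ x ≢ []
∷ʳ≢[] []      ()
∷ʳ≢[] (_ ∷ _) ()

-- The forest

module Forest (K m : ℕ) where

  private
    m^h*m≡m^[1+h] : ∀ h → m ^ h ℕ.* m ≡ m ^ suc h
    m^h*m≡m^[1+h] h = ℕP.*-comm (m ^ h) m

  unpos : ∀ h → Fin (m ^ suc h) → Fin (m ^ h) × Fin m
  unpos h p = F.remQuot m (F.cast (sym (m^h*m≡m^[1+h] h)) p)

  unpos-pos : ∀ h b i → unpos h (pos h b i) ≡ (b , i)
  unpos-pos h b i = trans
    (cong (F.remQuot m) (FP.cast-involutive (sym (m^h*m≡m^[1+h] h)) (m^h*m≡m^[1+h] h) _))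
    (FP.remQuot-combine b i)

  pos-surjective : ∀ h p → ∃₂ λ b i → p ≡ pos h b i
  pos-surjective h p = proj₁ (unpos h p) , proj₂ (unpos h p) , sym (trans
    (cong (F.cast (m^h*m≡m^[1+h] h)) (FP.combine-remQuot {m ^ h} m _))
    (FP.cast-involutive (m^h*m≡m^[1+h] h) (sym (m^h*m≡m^[1+h] h)) p))

  pos-injective : ∀ h {b i b′ i′} → pos h b i ≡ pos h b′ i′ → b ≡ b′ × i ≡ i′
  pos-injective h {b} {i} {b′} {i′} eq = ,-injectiveˡ unpos≡ , ,-injectiveʳ unpos≡
    where
    unpos≡ : (b , i) ≡ (b′ , i′)
    unpos≡ = trans (sym (unpos-pos h b i)) (trans (cong (unpos h) eq) (unpos-pos h b′ i′))

  digits : (Fin m → ℕ) → ∀ h → Fin (m ^ h) → List ℕ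
  digits f zero    p = []
  digits f (suc h) p = digits f h (proj₁ (unpos h p)) ∷ʳ f (proj₂ (unpos h p))

  digits-pos : ∀ f h b i → digits f (suc h) (pos h b i) ≡ digits f h b ∷ʳ f i
  digits-pos f h b i = cong (λ (b , i) → digits f h b ∷ʳ f i) (unpos-pos h b i)

  length-digits : ∀ f h p → length (digits f h p) ≡ h
  length-digits f zero    p = ≡.refl
  length-digits f (suc h) p = trans (LP.length-++ (digits f h _))
                                    (trans (cong (_+ 1) (length-digits f h _)) (ℕP.+-comm h 1))

  digits-injective : ∀ {f} → Injective _≡_ _≡_ f → ∀ h → Injective _≡_ _≡_ (digits f h)
  digits-injective f-injective zero {F.zero} {F.zero} _ = ≡.refl
  digits-injective {f} f-injective (suc h) {p} {q} eq
    with pos-surjective h p | pos-surjective h q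
  ... | b , i , ≡.refl | b′ , i′ , ≡.refl
    with LP.∷ʳ-injective (digits f h b) (digits f h b′)
           (trans (sym (digits-pos f h b i)) (trans eq (digits-pos f h b′ i′)))
  ... | b-digits , fi≡fi′ =
    cong₂ (pos h) (digits-injective f-injective h b-digits) (f-injective fi≡fi′)

  parent : ∀ h → Vec (Fin m) (m ^ suc h) → Fin (m ^ suc h) → Fin (m ^ suc (suc h))
  parent h σ b = pos (suc h) b (lookup σ b)

  rootPos : ∀ {h} → Stage K m h → Fin (m ^ h) → Fin (m ^ K)
  rootPos root            p = p
  rootPos (child {h} S σ) b = rootPos S (parent h σ b)

  rootPos-injective : ∀ {h} (S : Stage K m h) → Injective _≡_ _≡_ (rootPos S)
  rootPos-injective root            eq = eq
  rootPos-injective (child {h} S σ) eq = proj₁ (pos-injective (suc h) (rootPos-injective S eq))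

  digits-rootPos : ∀ f {h} (S : Stage K m h) p →
                   ∃ λ ds → digits f K (rootPos S p) ≡ digits f h p ++ ds
  digits-rootPos f root p = [] , sym (LP.++-identityʳ _)
  digits-rootPos f (child {h} S σ) b with digits-rootPos f S (parent h σ b)
  ... | ds , eq = f (lookup σ b) ∷ ds ,
        trans eq (trans (cong (_++ ds) (digits-pos f (suc h) b (lookup σ b)))
                        (LP.++-assoc (digits f (suc h) b) _ ds))

  height≤K : ∀ {h} → Stage K m h → h ℕ.≤ K
  height≤K root        = ℕP.≤-refl
  height≤K (child S σ) = ℕP.<⇒≤ (height≤K S)

  word : ∀ {h} → Stage K m h → List (List (Fin m))
  word root        = []
  word (child S σ) = word S ∷ʳ toList σ

  word-injective : ∀ {h₁ h₂} (S : Stage K m h₁) (T : Stage K m h₂) → word S ≡ word T →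
                   _≡_ {A = Σ ℕ (Stage K m)} (h₁ , S) (h₂ , T)
  word-injective root        root        _  = ≡.refl
  word-injective root        (child T τ) eq = ⊥-elim (∷ʳ≢[] (word T) (sym eq))
  word-injective (child S σ) root        eq = ⊥-elim (∷ʳ≢[] (word S) eq)
  word-injective (child S σ) (child T τ) eq with LP.∷ʳ-injective (word S) (word T) eq
  ... | S≡T , σ≡τ with word-injective S T S≡T
  ...   | ≡.refl with trans (sym (VP.cast-is-id ≡.refl σ)) (VP.toList-injective ≡.refl σ τ σ≡τ)
  ...     | ≡.refl = ≡.refl

  -- Clamped: beyond the root stage, ancestor stays at the root.
  ancestor : ∀ {h} → Stage K m h → Fin (m ^ h) → ℕ → Vertex K m
  ancestor {h} S               p zero    = h , S , p
  ancestor     root            p (suc j) = K , root , p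
  ancestor     (child {h} S σ) b (suc j) = ancestor S (parent h σ b) j

  ancestor-∈-path : ∀ {h} (S : Stage K m h) p j → ancestor S p j ∈ pathToRoot S p
  ancestor-∈-path root            p zero    = here ≡.refl
  ancestor-∈-path root            p (suc j) = here ≡.refl
  ancestor-∈-path (child S σ)     b zero    = here ≡.refl
  ancestor-∈-path (child {h} S σ) b (suc j) = there (ancestor-∈-path S (parent h σ b) j)

  private
    step-bound : ∀ {h} j → j + suc (suc h) ℕ.≤ K → suc j + suc h ℕ.≤ K
    step-bound {h} j = subst (ℕ._≤ K) (ℕP.+-suc j (suc h))

  ∈-path⇒ancestor : ∀ {h} (S : Stage K m h) p {v} → v ∈ pathToRoot S p →
                    ∃ λ j → j + h ℕ.≤ K × v ≡ ancestor S p j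
  ∈-path⇒ancestor root            p (here ≡.refl) = 0 , ℕP.≤-refl , ≡.refl
  ∈-path⇒ancestor (child S σ)     b (here ≡.refl) = 0 , height≤K (child S σ) , ≡.refl
  ∈-path⇒ancestor (child {h} S σ) b (there v∈)    with ∈-path⇒ancestor S (parent h σ b) v∈
  ... | j , j+h≤K , ≡.refl = suc j , step-bound j j+h≤K , ≡.refl

  ancestor-top : ∀ {h} (S : Stage K m h) p j → K ℕ.≤ j + h →
                 ancestor S p j ≡ (K , root , rootPos S p)
  ancestor-top root            p zero    _     = ≡.refl
  ancestor-top root            p (suc j) _     = ≡.refl
  ancestor-top (child S σ)     b zero    K≤h   = ⊥-elim (ℕP.<⇒≱ (height≤K S) K≤h)
  ancestor-top (child {h} S σ) b (suc j) K≤j+h =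
    ancestor-top S (parent h σ b) j (subst (K ℕ.≤_) (sym (ℕP.+-suc j (suc h))) K≤j+h)

  prefix⇒ancestor : ∀ {h h′} (S : Stage K m h) (T : Stage K m h′) p q R →
                    word S ≡ word T ++ R → rootPos T q ≡ rootPos S p →
                    ∃ λ j → j + h ℕ.≤ K × (h′ , T , q) ≡ ancestor S p j
  prefix⇒ancestor root T p q R eq q~p
    with word-injective T root (LP.++-conicalˡ (word T) R (sym eq))
  ... | ≡.refl with q~p
  ...   | ≡.refl = 0 , ℕP.≤-refl , ≡.refl
  prefix⇒ancestor (child {h} S σ) T b q R eq q~b with ∷ʳ-≡-++ (word S) (word T) R eq
  ... | inj₁ ≡.refl
    with word-injective T (child S σ) (sym (trans eq (LP.++-identityʳ (word T))))
  ...   | ≡.refl with rootPos-injective (child S σ) q~b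
  ...     | ≡.refl = 0 , height≤K (child S σ) , ≡.refl
  prefix⇒ancestor (child {h} S σ) T b q R eq q~b | inj₂ (R′ , eq′)
    with prefix⇒ancestor S T (parent h σ b) q R′ eq′ q~b
  ... | j , j+h≤K , w≡ = suc j , step-bound j j+h≤K , w≡

-- Keys of forest vertices

module Coding {A : Set} (_≟_ : DecidableEquality A)
              (ℓ : A → List ℕ) (ℓ-injective : Injective _≡_ _≡_ ℓ)
              (ℓ<terminal : ∀ a t → ℓ a Lex₁.< 1 ∷ t) where

  code : List A → List ℕ → List (List ℕ)
  code W t = map ℓ W ∷ʳ (1 ∷ t)

  code-++-∷ : ∀ W a R t → code (W ++ a ∷ R) t ≡ map ℓ W ++ ℓ a ∷ code R t
  code-++-∷ W a R t = trans (cong (_∷ʳ (1 ∷ t)) (LP.map-++ ℓ W (a ∷ R)))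
                            (LP.++-assoc (map ℓ W) (ℓ a ∷ map ℓ R) _)

  descendant-< : ∀ W a R t t′ → code (W ++ a ∷ R) t Lex₂.< code W t′
  descendant-< W a R t t′ = subst (Lex₂._< code W t′) (sym (code-++-∷ W a R t))
                                  (Lex₂.++⁺ˡ (map ℓ W) (Lex₂.this (ℓ<terminal a t′)))

  code-injective : ∀ {W V t s} → code W t ≡ code V s → W ≡ V × t ≡ s
  code-injective {W} {V} eq with LP.∷ʳ-injective (map ℓ W) (map ℓ V) eq
  ... | W≡V , t≡s = LP.map-injective ℓ-injective W≡V , LP.∷-injectiveʳ t≡s

  code-monoʳ-< : ∀ W {t t′} → t Lex₁.< t′ → code W t Lex₂.< code W t′
  code-monoʳ-< W t<t′ = Lex₂.++⁺ˡ (map ℓ W) (Lex₂.this (Lex₁.next ≡.refl t<t′))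

  code-cancelʳ-≤ : ∀ W {t t′} → code W t Lex₂.≤ code W t′ → t Lex₁.≤ t′
  code-cancelʳ-≤ W p = Lex₁.≤-tail ≡.refl (Lex₂.∷⁻-≤ (Lex₂.++⁻ˡ-≤ (map ℓ W) p))

  diverging-≤ : ∀ P a b R₁ R₂ {t s} →
                code (P ++ a ∷ R₁) t Lex₂.≤ code (P ++ b ∷ R₂) s → ℓ a Lex₁.≤ ℓ b
  diverging-≤ P a b R₁ R₂ p = Lex₂.∷⁻-≤ (Lex₂.++⁻ˡ-≤ (map ℓ P)
    (subst₂ Lex₂._≤_ (code-++-∷ P a R₁ _) (code-++-∷ P b R₂ _) p))

  code-sandwich : ∀ W V {t s t′} →
                  code W t Lex₂.≤ code V s → code V s Lex₂.≤ code W t′ → W ≡ V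
  code-sandwich W V p q with divergence _≟_ W V
  ... | equal     = ≡.refl
  ... | prefix    = ⊥-elim (Lex₂.<⇒≱ (descendant-< W _ _ _ _) p)
  ... | extension = ⊥-elim (Lex₂.<⇒≱ (descendant-< V _ _ _ _) q)
  ... | diverge {zs} {a} {b} a≢b = ⊥-elim (a≢b (ℓ-injective
    (Lex₁.≤-antisym (diverging-≤ zs a b _ _ p) (diverging-≤ zs b a _ _ q))))

module StageCoding (m : ℕ) where

  -- The leading 0 puts every letter below the terminal letter 1 ∷ _ of a code; the
  -- trailing sentinels make yLetter reverse xLetter also on a vector and its prefixes.
  xLetter yLetter : List (Fin m) → List ℕ
  xLetter a = 0 ∷ map (suc ∘ toℕ) a ∷ʳ 0
  yLetter a = 0 ∷ map ((m ∸_) ∘ toℕ) a ∷ʳ suc m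

  xLetter-injective : Injective _≡_ _≡_ xLetter
  xLetter-injective {a} {b} eq = LP.map-injective (FP.toℕ-injective ∘ ℕP.suc-injective)
    (proj₁ (LP.∷ʳ-injective (map _ a) (map _ b) (LP.∷-injectiveʳ eq)))

  yLetter-injective : Injective _≡_ _≡_ yLetter
  yLetter-injective {a} {b} eq = LP.map-injective
    (λ {i} {j} → FP.toℕ-injective ∘
                 ℕP.∸-cancelˡ-≡ (ℕP.<⇒≤ (FP.toℕ<n i)) (ℕP.<⇒≤ (FP.toℕ<n j)))
    (proj₁ (LP.∷ʳ-injective (map _ a) (map _ b) (LP.∷-injectiveʳ eq)))

  private
    flip-tails : ∀ (a b : List (Fin m)) →
                 map (suc ∘ toℕ) a ∷ʳ 0 Lex₁.< map (suc ∘ toℕ) b ∷ʳ 0 →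
                 map ((m ∸_) ∘ toℕ) b ∷ʳ suc m Lex₁.< map ((m ∸_) ∘ toℕ) a ∷ʳ suc m
    flip-tails []      []      (Lex₁.this ())
    flip-tails []      []      (Lex₁.next _ ())
    flip-tails []      (j ∷ b) _ = Lex₁.this (s≤s (ℕP.m∸n≤m m (toℕ j)))
    flip-tails (i ∷ a) []      (Lex₁.this ())
    flip-tails (i ∷ a) []      (Lex₁.next () _)
    flip-tails (i ∷ a) (j ∷ b) (Lex₁.this (s≤s i<j)) =
      Lex₁.this (ℕP.∸-monoʳ-< i<j (ℕP.<⇒≤ (FP.toℕ<n j)))
    flip-tails (i ∷ a) (j ∷ b) (Lex₁.next i≡j p) =
      Lex₁.next (cong (m ∸_) (sym (ℕP.suc-injective i≡j))) (flip-tails a b p)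

  xLetter-<⇒yLetter-> : ∀ {a b : List (Fin m)} →
                        xLetter a Lex₁.< xLetter b → yLetter b Lex₁.< yLetter a
  xLetter-<⇒yLetter-> (Lex₁.this ())
  xLetter-<⇒yLetter-> {a} {b} (Lex₁.next _ p) = Lex₁.next ≡.refl (flip-tails a b p)

  module X = Coding (LP.≡-dec F._≟_) xLetter xLetter-injective (λ _ _ → Lex₁.this (s≤s z≤n))
  module Y = Coding (LP.≡-dec F._≟_) yLetter yLetter-injective (λ _ _ → Lex₁.this (s≤s z≤n))

  diverging-codes : ∀ P (a b : List (Fin m)) R₁ R₂ {t t′ s s′} → a ≢ b →
                    X.code (P ++ a ∷ R₁) t Lex₂.≤ X.code (P ++ b ∷ R₂) t′ →
                    Y.code (P ++ a ∷ R₁) s Lex₂.≤ Y.code (P ++ b ∷ R₂) s′ → ⊥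
  diverging-codes P a b R₁ R₂ a≢b p q =
    Lex₁.<⇒≱ (xLetter-<⇒yLetter-> (Lex₁.≤∧≢⇒< (X.diverging-≤ P a b R₁ R₂ p)
                                              (a≢b ∘ xLetter-injective)))
             (Y.diverging-≤ P a b R₁ R₂ q)

  codes-≤⇒extension : ∀ W V {t t′ s s′} →
                      X.code W t Lex₂.≤ X.code V t′ → Y.code W s Lex₂.≤ Y.code V s′ →
                      ∃ λ R → W ≡ V ++ R
  codes-≤⇒extension W V p q with divergence (LP.≡-dec F._≟_) W V
  ... | equal            = [] , sym (LP.++-identityʳ W)
  ... | prefix           = ⊥-elim (Lex₂.<⇒≱ (Y.descendant-< W _ _ _ _) q)
  ... | extension        = _ , ≡.refl
  ... | diverge {zs} a≢b = ⊥-elim (diverging-codes zs _ _ _ _ a≢b p q)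

module Keys {k : ℕ} {H′ : OHyp} (R′ : ChainRealization ℕ._<_ k (mem H′)) where
  K m : ℕ
  K = suc k
  m = nV H′

  open ChainRealization R′ using () renaming
    ( X to X′; Y to Y′; X-injective to X′-injective; Y-injective to Y′-injective
    ; chain to chain′; chain-mem to chain′-mem; mem-chain to mem-chain′
    ; X-chain-< to X′-chain-<; Y-chain-< to Y′-chain-<; box to box′
    ; corners to corners′; corners-complete to corners′-complete; corners-sound to corners′-sound)
  open Forest K m
  open StageCoding m

  xKey yKey : Vertex K m → List (List ℕ)
  xKey (h , S , p) = X.code (word S) (digits X′ h p)
  yKey (h , S , p) = digits Y′ K (rootPos S p) ∷ Y.code (word S) []

  xKey-injective : Injective _≡_ _≡_ xKey
  xKey-injective {h₁ , S , p} {h₂ , T , q} eq with X.code-injective eq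
  ... | S≡T , p≡q with word-injective S T S≡T
  ...   | ≡.refl = cong (λ p → h₁ , S , p) (digits-injective X′-injective h₁ p≡q)

  yKey-injective : Injective _≡_ _≡_ yKey
  yKey-injective {h₁ , S , p} {h₂ , T , q} eq with LP.∷-injective eq
  ... | roots , codes with word-injective S T (proj₁ (Y.code-injective codes))
  ...   | ≡.refl =
    cong (λ p → h₁ , S , p) (rootPos-injective S (digits-injective Y′-injective K roots))

  infix 4 _⊏_
  record _⊏_ (v w : Vertex K m) : Set where
    constructor both
    field
      x-< : xKey v Lex₂.< xKey w
      y-< : yKey v Lex₂.< yKey w

  ⊏-trans : ∀ {u v w} → u ⊏ v → v ⊏ w → u ⊏ w
  ⊏-trans (both x₁ y₁) (both x₂ y₂) = both (Lex₂.<-trans x₁ x₂) (Lex₂.<-trans y₁ y₂)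

  child⊏parent : ∀ {h} (S : Stage K m (suc (suc h))) σ b →
                 (suc h , child S σ , b) ⊏ (suc (suc h) , S , parent h σ b)
  child⊏parent S σ b =
    both (X.descendant-< (word S) _ [] _ _) (Lex₂.next ≡.refl (Y.descendant-< (word S) _ [] _ _))

  private
    lift-bound : ∀ {h} j → suc j + suc h ℕ.≤ K → j + suc (suc h) ℕ.≤ K
    lift-bound {h} j = subst (ℕ._≤ K) (sym (ℕP.+-suc j (suc h)))

  ancestor-⊏ : ∀ {h} (S : Stage K m h) p i j → i ℕ.< j → j + h ℕ.≤ K →
               ancestor S p i ⊏ ancestor S p j
  ancestor-⊏ root            p i       (suc j)       _         j+K<K =
    ⊥-elim (ℕP.m+n≮n j K j+K<K)
  ancestor-⊏ (child S σ)     b zero    (suc zero)    _         _     = child⊏parent S σ b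
  ancestor-⊏ (child {h} S σ) b zero    (suc (suc j)) _         bound =
    ⊏-trans (child⊏parent S σ b)
            (ancestor-⊏ S (parent h σ b) zero (suc j) (s≤s z≤n) (lift-bound (suc j) bound))
  ancestor-⊏ (child {h} S σ) b (suc i) (suc j)       (s≤s i<j) bound =
    ancestor-⊏ S (parent h σ b) i j i<j (lift-bound j bound)

  path-box : ∀ {h} (S : Stage K m h) p w →
             xKey (h , S , p) Lex₂.≤ xKey w → yKey (h , S , p) Lex₂.≤ yKey w →
             yKey w Lex₂.≤ yKey (K , root , rootPos S p) →
             ∃ λ j → j + h ℕ.≤ K × w ≡ ancestor S p j
  path-box S p (h′ , T , q) x₁ y₁ y₂ with Lex₁.≤-antisym (Lex₂.∷⁻-≤ y₁) (Lex₂.∷⁻-≤ y₂)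
  ... | sameRootDigits
    with codes-≤⇒extension (word S) (word T) x₁ (Lex₂.≤-tail sameRootDigits y₁)
  ...   | R , S≡T++R =
    prefix⇒ancestor S T p q R S≡T++R (sym (digits-injective Y′-injective K sameRootDigits))

  block : ∀ {h} → Stage K m (suc h) → Fin (m ^ h) → Fin m → Vertex K m
  block {h} S b i = suc h , S , pos h b i

  rootDigits-block : ∀ {h} (S : Stage K m (suc h)) b i →
                     ∃ λ ds → digits Y′ K (rootPos S (pos h b i)) ≡
                              digits Y′ h b ++ Y′ i ∷ ds
  rootDigits-block {h} S b i with digits-rootPos Y′ S (pos h b i)
  ... | ds , eq = ds , trans eq (trans (cong (_++ ds) (digits-pos Y′ h b i))
                                       (LP.++-assoc (digits Y′ h b) _ ds))

  block-⊏ : ∀ {h} (S : Stage K m (suc h)) b {i j} → X′ i ℕ.< X′ j → Y′ i ℕ.< Y′ j →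
            block S b i ⊏ block S b j
  block-⊏ {h} S b {i} {j} xi<xj yi<yj = both
    (X.code-monoʳ-< (word S)
      (subst₂ Lex₁._<_ (sym (digits-pos X′ h b i)) (sym (digits-pos X′ h b j))
                       (Lex₁.++⁺ˡ (digits X′ h b) (Lex₁.this xi<xj))))
    (Lex₂.this
      (subst₂ Lex₁._<_ (sym (proj₂ (rootDigits-block S b i)))
                       (sym (proj₂ (rootDigits-block S b j)))
                       (Lex₁.++⁺ˡ (digits Y′ h b) (Lex₁.this yi<yj))))

  last-digit-≤ : ∀ f h b i i′ → digits f (suc h) (pos h b i) Lex₁.≤ digits f (suc h) (pos h b i′) →
                 f i ℕ<.≤ f i′
  last-digit-≤ f h b i i′ p = Lex₁.∷⁻-≤ (Lex₁.++⁻ˡ-≤ (digits f h b)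
    (subst₂ Lex₁._≤_ (digits-pos f h b i) (digits-pos f h b i′) p))

  same-block : ∀ {f} → Injective _≡_ _≡_ f → ∀ h b b′ i₁ i i₂ →
               digits f (suc h) (pos h b i₁) Lex₁.≤ digits f (suc h) (pos h b′ i) →
               digits f (suc h) (pos h b′ i) Lex₁.≤ digits f (suc h) (pos h b i₂) → b ≡ b′
  same-block {f} f-injective h b b′ i₁ i i₂ p q = digits-injective f-injective h
    (Lex₁.++-sandwich (digits f h b) (digits f h b′)
      (trans (length-digits f h b) (sym (length-digits f h b′)))
      (subst₂ Lex₁._≤_ (digits-pos f h b i₁) (digits-pos f h b′ i) p)
      (subst₂ Lex₁._≤_ (digits-pos f h b′ i) (digits-pos f h b i₂) q))

  root-digit-≤ : ∀ {h} (S : Stage K m (suc h)) b i i′ →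
                 yKey (block S b i) Lex₂.≤ yKey (block S b i′) → Y′ i ℕ<.≤ Y′ i′
  root-digit-≤ {h} S b i i′ p = Lex₁.∷⁻-≤ (Lex₁.++⁻ˡ-≤ (digits Y′ h b)
    (subst₂ Lex₁._≤_ (proj₂ (rootDigits-block S b i)) (proj₂ (rootDigits-block S b i′))
                     (Lex₂.∷⁻-≤ p)))

  block-box : ∀ {h} (S : Stage K m (suc h)) b i₁ i₂ w →
              xKey (block S b i₁) Lex₂.≤ xKey w → xKey w Lex₂.≤ xKey (block S b i₂) →
              yKey (block S b i₁) Lex₂.≤ yKey w → yKey w Lex₂.≤ yKey (block S b i₂) →
              ∃ λ i → w ≡ block S b i × X′ i₁ ℕ<.≤ X′ i × X′ i ℕ<.≤ X′ i₂
                                      × Y′ i₁ ℕ<.≤ Y′ i × Y′ i ℕ<.≤ Y′ i₂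
  block-box {h} S b i₁ i₂ (h′ , T , q) x₁ x₂ y₁ y₂
    with word-injective S T (X.code-sandwich (word S) (word T) x₁ x₂)
  ... | ≡.refl
    with pos-surjective h q | X.code-cancelʳ-≤ (word S) x₁ | X.code-cancelʳ-≤ (word S) x₂
  ...   | b′ , i , ≡.refl | x₁′ | x₂′ with same-block X′-injective h b b′ i₁ i i₂ x₁′ x₂′
  ...     | ≡.refl = i , ≡.refl ,
    last-digit-≤ X′ h b i₁ i x₁′ , last-digit-≤ X′ h b i i₂ x₂′ ,
    root-digit-≤ S b i₁ i y₁ , root-digit-≤ S b i i₂ y₂

  edgeVertex : ForestEdge K H′ → Fin K → Vertex K m
  edgeVertex (inj₁ (S , p))         i = ancestor S p (toℕ i)
  edgeVertex (inj₂ (h , S , b , e)) i = block S b (chain′ e i)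

  edgeVertex-mem : ∀ e i → forestMem K H′ e (edgeVertex e i)
  edgeVertex-mem (inj₁ (S , p))         i = ancestor-∈-path S p (toℕ i)
  edgeVertex-mem (inj₂ (h , S , b , e)) i = chain′ e i , chain′-mem e i , ≡.refl

  path-index : ∀ (S : Stage K m 1) p {j} → j + 1 ℕ.≤ K →
               ∃ λ i → ancestor S p j ≡ edgeVertex (inj₁ (S , p)) i
  path-index S p {j} bound = F.fromℕ< j<K , cong (ancestor S p) (sym (FP.toℕ-fromℕ< j<K))
    where j<K = subst (ℕ._≤ K) (ℕP.+-comm j 1) bound

  path-top : ∀ (S : Stage K m 1) p →
             edgeVertex (inj₁ (S , p)) (fromℕ k) ≡ (K , root , rootPos S p)
  path-top S p = trans (cong (ancestor S p) (FP.toℕ-fromℕ k))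
                       (ancestor-top S p k (ℕP.≤-reflexive (ℕP.+-comm 1 k)))

  mem-edgeVertex : ∀ e v → forestMem K H′ e v → ∃ λ i → v ≡ edgeVertex e i
  mem-edgeVertex (inj₁ (S , p)) v v∈ with ∈-path⇒ancestor S p v∈
  ... | j , bound , ≡.refl = path-index S p bound
  mem-edgeVertex (inj₂ (h , S , b , e)) v (i , i∈e , ≡.refl) with mem-chain′ e i i∈e
  ... | j , ≡.refl = j , ≡.refl

  edgeVertex-⊏ : ∀ e {i j} → i <ᶠ j → edgeVertex e i ⊏ edgeVertex e j
  edgeVertex-⊏ (inj₁ (S , p)) {i} {j} i<j =
    ancestor-⊏ S p (toℕ i) (toℕ j) i<j (subst (ℕ._≤ K) (ℕP.+-comm 1 (toℕ j)) (FP.toℕ<n j))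
  edgeVertex-⊏ (inj₂ (h , S , b , e)) i<j = block-⊏ S b (X′-chain-< e i<j) (Y′-chain-< e i<j)

  edgeVertex-box : ∀ e w →
                   xKey (edgeVertex e F.zero) Lex₂.≤ xKey w →
                   xKey w Lex₂.≤ xKey (edgeVertex e (fromℕ k)) →
                   yKey (edgeVertex e F.zero) Lex₂.≤ yKey w →
                   yKey w Lex₂.≤ yKey (edgeVertex e (fromℕ k)) →
                   ∃ λ i → w ≡ edgeVertex e i
  edgeVertex-box (inj₁ (S , p)) w x₁ _ y₁ y₂
    with path-box S p w x₁ y₁ (subst (λ v → yKey w Lex₂.≤ yKey v) (path-top S p) y₂)
  ... | j , bound , ≡.refl = path-index S p bound
  edgeVertex-box (inj₂ (h , S , b , e)) w x₁ x₂ y₁ y₂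
    with block-box S b (chain′ e F.zero) (chain′ e (fromℕ k)) w x₁ x₂ y₁ y₂
  ... | i , ≡.refl , x₁′ , x₂′ , y₁′ , y₂′ with box′ e i x₁′ x₂′ y₁′ y₂′
  ...   | j , ≡.refl = j , ≡.refl

  corner : ForestEdge K H′ → Vertex K m × Vertex K m
  corner e = edgeVertex e F.zero , edgeVertex e (fromℕ k)

  blockPair : ∀ {h} → Stage K m (suc h) → Fin (m ^ h) →
              Fin m × Fin m → Vertex K m × Vertex K m
  blockPair S b (i , j) = block S b i , block S b j

  pathCorners blockCorners : Vertex K m → List (Vertex K m × Vertex K m)
  pathCorners (zero        , S , p) = []
  pathCorners (suc zero    , S , p) = corner (inj₁ (S , p)) ∷ []
  pathCorners (suc (suc h) , S , p) = []
  blockCorners (zero  , S , p) = []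
  blockCorners (suc h , S , p) = map (blockPair S (proj₁ (unpos h p))) corners′

  cornersAt : Vertex K m → List (Vertex K m × Vertex K m)
  cornersAt v = pathCorners v ++ blockCorners v

  corner-∈-cornersAt : ∀ e → ∃ λ v → corner e ∈ cornersAt v
  corner-∈-cornersAt (inj₁ (S , p))         = (1 , S , p) , here ≡.refl
  corner-∈-cornersAt (inj₂ (h , S , b , e)) = v , ∈-++⁺ʳ (pathCorners v) blockCorner
    where
    v = block S b (chain′ e F.zero)
    blockCorner : corner (inj₂ (h , S , b , e)) ∈ blockCorners v
    blockCorner = subst (λ b′ → corner (inj₂ (h , S , b , e)) ∈ map (blockPair S b′) corners′)
                        (sym (cong proj₁ (unpos-pos h b (chain′ e F.zero))))
                        (∈-map⁺ (blockPair S b) (corners′-complete e))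

  cornersAt-sound : ∀ v {c} → c ∈ cornersAt v → ∃ λ e → corner e ≡ c
  cornersAt-sound v c∈ with ∈-++⁻ (pathCorners v) c∈
  cornersAt-sound (suc zero , S , p) _ | inj₁ (here ≡.refl) = inj₁ (S , p) , ≡.refl
  cornersAt-sound (suc h , S , p) _ | inj₂ c∈blocks
    with ∈-map⁻ (blockPair S (proj₁ (unpos h p))) c∈blocks
  ... | _ , c∈′ , ≡.refl with corners′-sound c∈′
  ...   | e , ≡.refl = inj₂ (h , S , proj₁ (unpos h p) , e) , ≡.refl

  forestRealization : (vs : List (Vertex K m)) → (∀ v → v ∈ vs) →
                      ChainRealization Lex₂._<_ k (forestMem K H′)
  forestRealization vs all-∈ = record
    { X = xKey ; Y = yKey ; X-injective = xKey-injective ; Y-injective = yKey-injective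
    ; chain = edgeVertex ; chain-mem = edgeVertex-mem ; mem-chain = mem-edgeVertex
    ; X-chain-< = λ e i<j → _⊏_.x-< (edgeVertex-⊏ e i<j)
    ; Y-chain-< = λ e i<j → _⊏_.y-< (edgeVertex-⊏ e i<j)
    ; box = edgeVertex-box
    ; corners = concatMap cornersAt vs
    ; corners-complete = λ e → let v , c∈ = corner-∈-cornersAt e in
                               ∈-concatMap⁺ cornersAt (lose (all-∈ v) c∈)
    ; corners-sound = λ c∈ →
        let v , c∈v = satisfied (∈-concatMap⁻ cornersAt {xs = vs} c∈) in cornersAt-sound v c∈v
    }

↔-enumeration : ∀ {n} {V : Set} → Fin n ↔ V → ∃ λ (vs : List V) → ∀ v → v ∈ vs
↔-enumeration {n} f = map to (allFin n) , λ v →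
  subst (_∈ map to (allFin n)) (Inverse.strictlyInverseˡ f v) (∈-map⁺ to (∈-allFin (from v)))
  where open Inverse f using (to; from)

chainRealization : ∀ k {c} (d : HData (suc k) c) → ChainRealization ℕ._<_ k (mem (hyp d))
chainRealization k base = baseRealization k
chainRealization k (step d n ord) =
  let vs , all-∈ = ↔-enumeration ord in
  rankRealization Lex₂.isStrictTotalOrder
    (relabel ord (Keys.forestRealization (chainRealization k d) vs all-∈))

open import Data.Nat using (_≤_)

lemma2 : (k c : ℕ) → 1 ≤ k → 1 ≤ c → (d : HData k c) → RealizedAscending k (hyp d)
lemma2 (suc k) c _ _ d = realize (chainRealization k d)
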